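{- Let $G$ be a grid graph and let $f:\mathbb{Z}^2\to\mathbb{R}^2$, $f(x,y)=(x,y)$, be the natural labeling of $P_\infty\,\Box\,P_\infty$. Let $k\geq2$ be an integer. If $G$ contains $P_{2k-3}\,\Box\,P_{2k-3}$ as a subgraph and the restriction of $f$ to $V(G)$ is a $k$-monotone-geodesic labeling of $G$, then $\mathrm{gp}^k(G)=(k-1)^2$.
   Context: $P_\infty\,\Box\,P_\infty$ has vertex set $\mathbb{Z}^2$, with $(x,y)$ and $(x',y')$ adjacent iff they differ by exactly $1$ in exactly one coordinate. A grid graph is an induced connected subgraph of $P_\infty\,\Box\,P_\infty$. $P_m\,\Box\,P_m$ denotes the Cartesian product of two paths on $m$ vertices (the $m\times m$ grid). A geodesic of a graph is a shortest path between two of its vertices. For a graph $G$ and $k\ge2$, $\mathrm{gp}^k(G)$ is the largest cardinality of a set $S\subseteq V(G)$ such that no geodesic of $G$ contains $k$ or more vertices of $S$. A sequence of points $((x_1,y_1),\ldots,(x_k,y_k))$ in $\mathbb{R}^2$ is monotone if both coordinate sequences $(x_i)$ and $(y_i)$ are monotone (each nondecreasing or nonincreasing). An injective function $f:V(G)\to\mathbb{R}^2$ is a $k$-monotone-geodesic labeling of $G$ if whenever $v_1,\ldots,v_k\in V(G)$ and $(f(v_1),\ldots,f(v_k))$ is monotone, there is a geodesic $g$ of $G$ whose vertex set contains $v_1,\ldots,v_k$. -}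

module Defs where

open import Data.Nat using (ℕ; _≤_; _≥_)
open import Data.Integer as ℤ using (ℤ; ∣_∣; _-_)
open import Data.Product using (_×_; _,_; Σ; ∃; proj₁; proj₂)
open import Data.Sum using (_⊎_)
open import Data.Fin using (Fin; toℕ)
open import Data.Maybe using (just)
open import Data.List using (List; length; head; last; map)
open import Data.List.Relation.Unary.All using (All)
open import Data.List.Relation.Unary.Linked using (Linked)
open import Data.List.Relation.Unary.Unique.Propositional using (Unique)
open import Data.List.Membership.Propositional using (_∈_)
open import Relation.Binary.PropositionalEquality using (_≡_)
open import Relation.Nullary using (¬_)

Pt : Set
Pt = ℤ × ℤ

Adj : Pt → Pt → Set
Adj (x , y) (x' , y') =
  (x ≡ x' × ∣ y - y' ∣ ≡ 1) ⊎ (y ≡ y' × ∣ x - x' ∣ ≡ 1)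

-- A (possibly infinite) induced subgraph of P∞ □ P∞ is given by its vertex set.
VSet : Set₁
VSet = Pt → Set

IsWalk : VSet → Pt → Pt → List Pt → Set
IsWalk V u v ws = All V ws × Linked Adj ws × head ws ≡ just u × last ws ≡ just v

Connected : VSet → Set
Connected V = ∀ u v → V u → V v → ∃ λ ws → IsWalk V u v ws

GridGraph : VSet → Set
GridGraph V = Connected V

IsGeodesic : VSet → List Pt → Set
IsGeodesic V g = Σ Pt λ u → Σ Pt λ v →
  IsWalk V u v g × Unique g × (∀ ws → IsWalk V u v ws → length g ≤ length ws)

AdjFin : {m : ℕ} → Fin m × Fin m → Fin m × Fin m → Set
AdjFin (i , j) (i' , j') =
  Adj (ℤ.+ toℕ i , ℤ.+ toℕ j) (ℤ.+ toℕ i' , ℤ.+ toℕ j')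

ContainsSquareGrid : VSet → ℕ → Set
ContainsSquareGrid V m = Σ (Fin m × Fin m → Pt) λ φ →
  (∀ p → V (φ p)) ×
  (∀ p q → φ p ≡ φ q → p ≡ q) ×
  (∀ p q → AdjFin p q → Adj (φ p) (φ q))

Monotoneℤ : List ℤ → Set
Monotoneℤ zs = Linked ℤ._≤_ zs ⊎ Linked ℤ._≥_ zs

MonotonePts : List Pt → Set
MonotonePts ps = Monotoneℤ (map proj₁ ps) × Monotoneℤ (map proj₂ ps)

-- the restriction of the natural labeling f(x,y) = (x,y) to V(G) is a
-- k-monotone-geodesic labeling of G
NaturalLabelingMonGeod : VSet → ℕ → Set
NaturalLabelingMonGeod V k = ∀ (vs : List Pt) → length vs ≡ k → All V vs →
  MonotonePts vs → ∃ λ g → IsGeodesic V g × All (_∈ g) vs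

IsGPk : VSet → ℕ → List Pt → Set
IsGPk V k S = Unique S × All V S ×
  (∀ g → IsGeodesic V g → ¬ (∃ λ T → Unique T × length T ≥ k × All (_∈ S) T × All (_∈ g) T))

GpkEq : VSet → ℕ → ℕ → Set
GpkEq V k n = (∃ λ S → IsGPk V k S × length S ≡ n) × (∀ S → IsGPk V k S → length S ≤ n)

-- With r = k - 2, the (2r+1)×(2r+1) grid contains the diamond
-- {(i + j , i + (r - j)) : 0 ≤ i, j ≤ r} of (k-1)² points, which all have the same chessboard
-- colour and are pairwise joined by walks of length at most 2r inside the grid, hence inside G.
-- On a geodesic of G, the stretch between the first and the last diamond point it meets is a
-- shortest walk, so it has at most 2r edges; colours alternate along it, so it contains at most
-- r + 1 = k - 1 points of one colour.
--
-- Upper bound. By the Erdős–Szekeres theorem, (k-1)² + 1 distinct points contain k points forming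
-- a monotone sequence, and the labelling hypothesis puts these on a common geodesic.

module Submission where

open import Defs
open import Level using (0ℓ)
open import Function using (_∘_; id)
open import Data.Empty using (⊥; ⊥-elim)
open import Data.Bool using (true; false)
open import Data.Maybe using (just)
open import Data.Nat as ℕ using (ℕ; zero; suc; _+_; _*_; _∸_; _<_; _≤_; _≥_; z≤n; s≤s; ∣_-_∣; parity)
import Data.Nat.Properties as ℕₚ
open import Data.Nat.Solver using (module +-*-Solver)
open import Data.Integer as ℤ using (ℤ; +_; -[1+_]; _-_)
import Data.Integer.Properties as ℤₚ
open import Data.Integer.Solver using () renaming (module +-*-Solver to ℤSolver)
open import Data.Parity as ℙ using (Parity; 0ℙ; 1ℙ; _⁻¹)
import Data.Parity.Properties as ℙₚ
import Data.Product as Product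
open import Data.Fin as Fin using (Fin; toℕ)
import Data.Fin.Properties as Finₚ
open import Data.Product.Properties using (≡-dec; ×-≡,≡→≡)
open import Data.Product using (_×_; _,_; ∃; proj₁; proj₂)
open import Data.Sum using (_⊎_; inj₁; inj₂; [_,_]′)
import Data.Sum as Sum
open import Data.List using (List; []; _∷_; _++_; length; filter; head; last; map; allFin)
open import Data.List.Properties using (length-++; length-map; length-tabulate)
open import Data.List.Relation.Unary.All as All using (All; []; _∷_)
import Data.List.Relation.Unary.All.Properties as Allₚ
open import Data.List.Relation.Unary.Any as Any using (Any; here; there)
open import Data.List.Relation.Unary.Linked as Linked using (Linked; [-]; _∷_)
import Data.List.Relation.Unary.Linked.Properties as Linkedₚ
open import Data.List.Relation.Unary.AllPairs as AllPairs using (_∷_)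
open import Data.List.Relation.Unary.Unique.Propositional using (Unique)
import Data.List.Relation.Unary.Unique.Propositional.Properties as Uniqueₚ
open import Data.List.Membership.Propositional using (_∈_; lose; find)
open import Data.List.Membership.Propositional.Properties
  using (∈-∃++; ∈-map⁻; ∈-++⁻; ∈-++⁺ˡ; ∈-++⁺ʳ; ∈-filter⁺; ∈-filter⁻)
open import Relation.Binary using (Rel; DecidableEquality)
open import Relation.Binary.Definitions using () renaming (Decidable to Decidable₂)
open import Relation.Binary.PropositionalEquality
  using (_≡_; _≢_; refl; sym; trans; cong; cong₂; subst; subst₂; module ≡-Reasoning)
open import Relation.Nullary using (¬_; Dec; yes; no; does; ¬?)
open import Relation.Nullary.Decidable using (_×-dec_)
open import Relation.Unary using (Pred; Decidable; ∁)
open import Relation.Unary.Properties using (∁?)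

module _ {A : Set} where

  length-filter-∁ : {P : Pred A 0ℓ} (P? : Decidable P) (xs : List A) →
                    length (filter (∁? P?) xs) + length (filter P? xs) ≡ length xs
  length-filter-∁ P? [] = refl
  length-filter-∁ P? (x ∷ xs) with does (P? x)
  ... | true  = trans (ℕₚ.+-suc _ _) (cong suc (length-filter-∁ P? xs))
  ... | false = cong suc (length-filter-∁ P? xs)

  Unique⇒length≤ : {xs ys : List A} → Unique xs → All (_∈ ys) xs → length xs ≤ length ys
  Unique⇒length≤ {[]} _ _ = z≤n
  Unique⇒length≤ {x ∷ xs} (x∉xs ∷ uxs) (x∈ys ∷ xs⊆ys) with ∈-∃++ x∈ys
  ... | ys₁ , ys₂ , refl = begin
      suc (length xs)                    ≤⟨ s≤s (Unique⇒length≤ uxs (All.zipWith remove (xs⊆ys , x∉xs))) ⟩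
      suc (length (ys₁ ++ ys₂))          ≡⟨ cong suc (length-++ ys₁) ⟩
      suc (length ys₁ + length ys₂)      ≡⟨ ℕₚ.+-suc (length ys₁) (length ys₂) ⟨
      length ys₁ + length (x ∷ ys₂)      ≡⟨ length-++ ys₁ ⟨
      length (ys₁ ++ x ∷ ys₂)            ∎
    where
    open ℕₚ.≤-Reasoning
    remove : ∀ {z} → z ∈ ys₁ ++ x ∷ ys₂ × x ≢ z → z ∈ ys₁ ++ ys₂
    remove (z∈ , x≢z) with ∈-++⁻ ys₁ z∈
    ... | inj₁ z∈ys₁         = ∈-++⁺ˡ z∈ys₁
    ... | inj₂ (here z≡x)    = ⊥-elim (x≢z (sym z≡x))
    ... | inj₂ (there z∈ys₂) = ∈-++⁺ʳ ys₁ z∈ys₂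

  Unique⇒length≤1 : {xs : List A} → Unique xs →
                    (∀ {p q} → p ∈ xs → q ∈ xs → p ≢ q → ⊥) → length xs ≤ 1
  Unique⇒length≤1 {[]}         _                 _        = z≤n
  Unique⇒length≤1 {_ ∷ []}     _                 _        = s≤s z≤n
  Unique⇒length≤1 {_ ∷ _ ∷ _} ((p≢q ∷ _) ∷ _) distinct = ⊥-elim (distinct (here refl) (there (here refl)) p≢q)

-- Erdős–Szekeres

Chain : {A : Set} → Rel A 0ℓ → List A → ℕ → Set
Chain R X n = ∃ λ c → Linked R c × All (_∈ X) c × length c ≡ n

Chain-⊆ : {A : Set} {R : Rel A 0ℓ} {X Y : List A} {n : ℕ} →
          (∀ {x} → x ∈ X → x ∈ Y) → Chain R X n → Chain R Y n
Chain-⊆ X⊆Y (c , linked , c⊆X , len) = c , linked , All.map X⊆Y c⊆X , len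

Comparable : {A : Set} → Rel A 0ℓ → Rel A 0ℓ
Comparable R p q = R p q ⊎ R q p

module Minimal {A : Set} {R : Rel A 0ℓ} (R? : Decidable₂ R) (X : List A) where

  HasPredecessor : Pred A 0ℓ
  HasPredecessor e = Any (λ s → R s e) X

  hasPredecessor? : Decidable HasPredecessor
  hasPredecessor? e = Any.any? (λ s → R? s e) X

  minimal nonMinimal : List A
  minimal    = filter (∁? hasPredecessor?) X
  nonMinimal = filter hasPredecessor? X

  length-minimal+nonMinimal : length minimal + length nonMinimal ≡ length X
  length-minimal+nonMinimal = length-filter-∁ hasPredecessor? X

  minimal⊆ : ∀ {x} → x ∈ minimal → x ∈ X
  minimal⊆ = proj₁ ∘ ∈-filter⁻ (∁? hasPredecessor?) {xs = X}

  nonMinimal⊆ : ∀ {x} → x ∈ nonMinimal → x ∈ X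
  nonMinimal⊆ = proj₁ ∘ ∈-filter⁻ hasPredecessor? {xs = X}

  Unique-minimal : Unique X → Unique minimal
  Unique-minimal = Uniqueₚ.filter⁺ (∁? hasPredecessor?)

  Unique-nonMinimal : Unique X → Unique nonMinimal
  Unique-nonMinimal = Uniqueₚ.filter⁺ hasPredecessor?

  minimal-isMinimal : ∀ {p q} → p ∈ X → q ∈ minimal → ¬ R p q
  minimal-isMinimal p∈X q∈min Rpq = proj₂ (∈-filter⁻ (∁? hasPredecessor?) {xs = X} q∈min) (lose p∈X Rpq)

  extend : ∀ {n} → Chain R nonMinimal (suc n) → Chain R X (suc (suc n))
  extend (e ∷ c , linked , e∈ ∷ c⊆ , len) with find (proj₂ (∈-filter⁻ hasPredecessor? {xs = X} e∈))
  ... | s , s∈X , Rse =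
    s ∷ e ∷ c , Rse ∷ linked , s∈X ∷ nonMinimal⊆ e∈ ∷ All.map nonMinimal⊆ c⊆ , cong suc len

Comparable⇒Chain : {A : Set} {R : Rel A 0ℓ} (R? : Decidable₂ R) (b : ℕ) (X : List A) → Unique X →
                   (∀ {p q} → p ∈ X → q ∈ X → p ≢ q → Comparable R p q) →
                   b < length X → Chain R X (suc b)
Comparable⇒Chain R? zero    (x ∷ _) _  _          _   = x ∷ [] , [-] , here refl ∷ [] , refl
Comparable⇒Chain R? (suc b) X       uX comparable b<X =
  extend (Comparable⇒Chain R? b nonMinimal (Unique-nonMinimal uX)
            (λ p∈ q∈ → comparable (nonMinimal⊆ p∈) (nonMinimal⊆ q∈)) b<nonMinimal)
  where
  open Minimal R? X
  atMostOneMinimal : length minimal ≤ 1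
  atMostOneMinimal = Unique⇒length≤1 (Unique-minimal uX) λ p∈ q∈ p≢q →
    [ minimal-isMinimal (minimal⊆ p∈) q∈ , minimal-isMinimal (minimal⊆ q∈) p∈ ]′
      (comparable (minimal⊆ p∈) (minimal⊆ q∈) p≢q)
  b<nonMinimal : b < length nonMinimal
  b<nonMinimal = ℕₚ.≤-pred (begin
    suc (suc b)                           ≤⟨ b<X ⟩
    length X                              ≡⟨ length-minimal+nonMinimal ⟨
    length minimal + length nonMinimal    ≤⟨ ℕₚ.+-monoˡ-≤ (length nonMinimal) atMostOneMinimal ⟩
    suc (length nonMinimal)               ∎)
    where open ℕₚ.≤-Reasoning

-- Mirsky's argument: peel off the R-minimal elements, which are pairwise S-comparable.
erdős-szekeres : {A : Set} {R S : Rel A 0ℓ} → Decidable₂ R → Decidable₂ S →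
                 (∀ {p q} → p ≢ q → Comparable R p q ⊎ Comparable S p q) →
                 ∀ a K (X : List A) → Unique X → a * K < length X →
                 Chain R X (suc a) ⊎ Chain S X (suc K)
erdős-szekeres R? S? comparable zero    K (x ∷ _) _  _  = inj₁ (x ∷ [] , [-] , here refl ∷ [] , refl)
erdős-szekeres {R = R} {S} R? S? comparable (suc a) K X uX lt = peel (K ℕ.<? length minimal)
  where
  open Minimal R? X
  peel : Dec (K < length minimal) → Chain R X (suc (suc a)) ⊎ Chain S X (suc K)
  peel (yes K<minimal) = inj₂ (Chain-⊆ minimal⊆
    (Comparable⇒Chain S? K minimal (Unique-minimal uX) S-comparable K<minimal))
    where
    S-comparable : ∀ {p q} → p ∈ minimal → q ∈ minimal → p ≢ q → Comparable S p q
    S-comparable p∈ q∈ p≢q = Sum.fromInj₂ (⊥-elim ∘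
      [ minimal-isMinimal (minimal⊆ p∈) q∈ , minimal-isMinimal (minimal⊆ q∈) p∈ ]′)
      (comparable p≢q)
  peel (no K≮minimal) = Sum.map extend (Chain-⊆ nonMinimal⊆)
    (erdős-szekeres R? S? comparable a K nonMinimal (Unique-nonMinimal uX) aK<nonMinimal)
    where
    aK<nonMinimal : a * K < length nonMinimal
    aK<nonMinimal = ℕₚ.+-cancelˡ-< K (a * K) (length nonMinimal) (begin-strict
      K + a * K                             <⟨ lt ⟩
      length X                              ≡⟨ length-minimal+nonMinimal ⟨
      length minimal + length nonMinimal    ≤⟨ ℕₚ.+-monoˡ-≤ (length nonMinimal) (ℕₚ.≮⇒≥ K≮minimal) ⟩
      K + length nonMinimal                 ∎)
      where open ℕₚ.≤-Reasoning

-- Chessboard colouring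

module Alternation {A : Set} {R : Rel A 0ℓ} (colour : A → Parity)
         (flips : ∀ {a b} → R a b → colour b ≡ colour a ⁻¹) (ρ : Parity) where

  coloured : List A → List A
  coloured = filter (λ a → colour a ℙₚ.≟ ρ)

  alternating-count     : ∀ {x xs} → Linked R (x ∷ xs) → 2 * length (coloured (x ∷ xs)) ≤ 2 + length xs
  alternating-count-off : ∀ {x xs} → Linked R (x ∷ xs) → colour x ≢ ρ →
                          2 * length (coloured (x ∷ xs)) ≤ 1 + length xs

  alternating-count {x} {xs} linked with colour x ℙₚ.≟ ρ
  alternating-count {xs = []}    _              | yes _    = s≤s (s≤s z≤n)
  alternating-count {xs = y ∷ ys} (Rxy ∷ linked) | yes x≡ρ  = begin
    2 * suc (length (coloured (y ∷ ys)))   ≡⟨ ℕₚ.*-suc 2 _ ⟩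
    2 + 2 * length (coloured (y ∷ ys))     ≤⟨ ℕₚ.+-monoʳ-≤ 2 (alternating-count-off linked y≢ρ) ⟩
    2 + suc (length ys)                    ∎
    where
    open ℕₚ.≤-Reasoning
    y≢ρ : colour y ≢ ρ
    y≢ρ y≡ρ = ℙₚ.p≢p⁻¹ ρ (trans (sym y≡ρ) (trans (flips Rxy) (cong _⁻¹ x≡ρ)))
  alternating-count {xs = []}    _      | no _ = z≤n
  alternating-count {xs = _ ∷ _} linked | no _ = ℕₚ.m≤n⇒m≤1+n (alternating-count (Linked.tail linked))

  alternating-count-off {x} linked x≢ρ with colour x ℙₚ.≟ ρ
  ... | yes x≡ρ = ⊥-elim (x≢ρ x≡ρ)
  alternating-count-off {xs = []}    _      _ | no _ = z≤n
  alternating-count-off {xs = _ ∷ _} linked _ | no _ = alternating-count (Linked.tail linked)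

parity-suc : ∀ n → parity (suc n) ≡ parity n ⁻¹
parity-suc n = sym (ℙₚ.⁻¹-selfInverse (ℙₚ.suc-homo-⁻¹ n))

parityℤ : ℤ → Parity
parityℤ z = parity ℤ.∣ z ∣

parityℤ-unit+ : ∀ u z → ℤ.∣ u ∣ ≡ 1 → parityℤ (u ℤ.+ z) ≡ parityℤ z ⁻¹
parityℤ-unit+ (+ 1)     (+ n)            _ = parity-suc n
parityℤ-unit+ (+ 1)     -[1+ zero ]      _ = refl
parityℤ-unit+ (+ 1)     -[1+ suc n ]     _ = parity-suc n
parityℤ-unit+ -[1+ 0 ]  (+ zero)         _ = refl
parityℤ-unit+ -[1+ 0 ]  (+ suc n)        _ = sym (ℙₚ.suc-homo-⁻¹ n)
parityℤ-unit+ -[1+ 0 ]  -[1+ n ]         _ = sym (ℙₚ.suc-homo-⁻¹ n)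
parityℤ-unit+ (+ zero)          _ ()
parityℤ-unit+ (+ suc (suc _))   _ ()
parityℤ-unit+ -[1+ suc _ ]      _ ()

parityℤ-flip : ∀ z z' → ℤ.∣ z - z' ∣ ≡ 1 → parityℤ z ≡ parityℤ z' ⁻¹
parityℤ-flip z z' unit = trans (cong parityℤ z≡[z-z']+z') (parityℤ-unit+ (z - z') z' unit)
  where
  open ℤSolver
  z≡[z-z']+z' : z ≡ (z - z') ℤ.+ z'
  z≡[z-z']+z' = solve 2 (λ z z' → z := (z :- z') :+ z') refl z z'

colour : Pt → Parity
colour (x , y) = parityℤ x ℙ.+ parityℤ y

+-⁻¹ʳ : ∀ p q → p ℙ.+ q ⁻¹ ≡ (p ℙ.+ q) ⁻¹
+-⁻¹ʳ 0ℙ q = refl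
+-⁻¹ʳ 1ℙ q = refl

+-⁻¹ˡ : ∀ p q → p ⁻¹ ℙ.+ q ≡ (p ℙ.+ q) ⁻¹
+-⁻¹ˡ p q = trans (ℙₚ.+-comm (p ⁻¹) q) (trans (+-⁻¹ʳ q p) (cong _⁻¹ (ℙₚ.+-comm q p)))

Adj-sym : ∀ {p q} → Adj p q → Adj q p
Adj-sym {_ , y} {_ , y'} (inj₁ (refl , unit)) = inj₁ (refl , trans (ℤₚ.∣i-j∣≡∣j-i∣ y' y) unit)
Adj-sym {x , _} {x' , _} (inj₂ (refl , unit)) = inj₂ (refl , trans (ℤₚ.∣i-j∣≡∣j-i∣ x' x) unit)

Adj-flips-colour : ∀ {p q} → Adj p q → colour q ≡ colour p ⁻¹
Adj-flips-colour {x , y} {_ , y'} (inj₁ (refl , unit)) =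
  trans (cong (parityℤ x ℙ.+_) (parityℤ-flip y' y (trans (ℤₚ.∣i-j∣≡∣j-i∣ y' y) unit)))
        (+-⁻¹ʳ (parityℤ x) (parityℤ y))
Adj-flips-colour {x , y} {x' , _} (inj₂ (refl , unit)) =
  trans (cong (ℙ._+ parityℤ y) (parityℤ-flip x' x (trans (ℤₚ.∣i-j∣≡∣j-i∣ x' x) unit)))
        (+-⁻¹ˡ (parityℤ x) (parityℤ y))

-- Walks and geodesics

endpoint : {A : Set} → A → List A → A
endpoint x []       = x
endpoint _ (y ∷ ys) = endpoint y ys

module _ {A : Set} where

  endpoint-++ : ∀ (x : A) xs ys → endpoint x (xs ++ ys) ≡ endpoint (endpoint x xs) ys
  endpoint-++ x []       ys = refl
  endpoint-++ _ (y ∷ xs) ys = endpoint-++ y xs ys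

  last-infix : ∀ (as : List A) x xs ys → last (as ++ x ∷ xs ++ ys) ≡ just (endpoint x (xs ++ ys))
  last-infix []            x []       []       = refl
  last-infix []            x []       (y ∷ ys) = last-infix [] y [] ys
  last-infix []            x (y ∷ xs) ys       = last-infix [] y xs ys
  last-infix (_ ∷ [])      x xs       ys       = last-infix [] x xs ys
  last-infix (_ ∷ a ∷ as)  x xs       ys       = last-infix (a ∷ as) x xs ys

  head-infix : ∀ (as : List A) x xs ys → head (as ++ x ∷ xs) ≡ head (as ++ x ∷ ys)
  head-infix []      _ _ _ = refl
  head-infix (_ ∷ _) _ _ _ = refl

  length-infix : ∀ (as : List A) x xs ys →
                 length (as ++ x ∷ xs ++ ys) ≡ length as + suc (length xs + length ys)
  length-infix as x xs ys = trans (length-++ as) (cong (λ n → length as + suc n) (length-++ xs))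

module _ {A : Set} {R : Rel A 0ℓ} where

  Linked-join : ∀ {x} xs {ys} → Linked R (x ∷ xs) → Linked R (endpoint x xs ∷ ys) → Linked R (x ∷ xs ++ ys)
  Linked-join []       _          linked' = linked'
  Linked-join (_ ∷ xs) (r ∷ linked) linked' = r ∷ Linked-join xs linked linked'

  Linked-split : ∀ {x} xs {ys} → Linked R (x ∷ xs ++ ys) → Linked R (x ∷ xs) × Linked R (endpoint x xs ∷ ys)
  Linked-split []       linked       = [-] , linked
  Linked-split (_ ∷ xs) (r ∷ linked) = Product.map₁ (r ∷_) (Linked-split xs linked)

  Linked-dropPrefix : ∀ as {bs} → Linked R (as ++ bs) → Linked R bs
  Linked-dropPrefix []       linked = linked
  Linked-dropPrefix (_ ∷ as) linked = Linked-dropPrefix as (Linked.tail linked)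

  Linked-replaceSuffix : ∀ as {b bs bs'} → Linked R (as ++ b ∷ bs) → Linked R (b ∷ bs') →
                         Linked R (as ++ b ∷ bs')
  Linked-replaceSuffix []           _            linked' = linked'
  Linked-replaceSuffix (_ ∷ [])     (r ∷ _)      linked' = r ∷ linked'
  Linked-replaceSuffix (_ ∷ a ∷ as) (r ∷ linked) linked' = r ∷ Linked-replaceSuffix (a ∷ as) linked linked'

record Walk (V : VSet) (x y : Pt) (n : ℕ) : Set where
  constructor walk
  field
    steps   : List Pt
    linked  : Linked Adj (x ∷ steps)
    inside  : All V (x ∷ steps)
    reaches : endpoint x steps ≡ y
    short   : length steps ≤ n

open Walk

module _ {V : VSet} where

  stay : ∀ {x} → V x → Walk V x x 0
  stay x∈V = walk [] [-] (x∈V ∷ []) refl z≤n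

  step : ∀ {x y z n} → Adj x y → V x → Walk V y z n → Walk V x z (suc n)
  step {y = y} xy x∈V (walk ws linked inside reaches short) =
    walk (y ∷ ws) (xy ∷ linked) (x∈V ∷ inside) reaches (s≤s short)

  _++ᵂ_ : ∀ {x y z m n} → Walk V x y m → Walk V y z n → Walk V x z (m + n)
  _++ᵂ_ {x} (walk ws linked inside refl short) (walk ws' linked' inside' reaches' short') =
    walk (ws ++ ws')
         (Linked-join ws linked linked')
         (Allₚ.++⁺ inside (All.tail inside'))
         (trans (endpoint-++ x ws ws') reaches')
         (subst (_≤ _) (sym (length-++ ws)) (ℕₚ.+-mono-≤ short short'))

  Walk-weaken : ∀ {x y m n} → m ≤ n → Walk V x y m → Walk V x y n
  Walk-weaken m≤n (walk ws linked inside reaches short) = walk ws linked inside reaches (ℕₚ.≤-trans short m≤n)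

  IsWalk-replaceInfix : ∀ as {x mid cs u v n} (w : Walk V x (endpoint x mid) n) →
                        IsWalk V u v (as ++ x ∷ mid ++ cs) → IsWalk V u v (as ++ x ∷ steps w ++ cs)
  IsWalk-replaceInfix as {x} {mid} {cs} {v = v} (walk ws linked' inside' reaches' _)
                      (inside , linked , hd , lst) =
      Allₚ.++⁺ (Allₚ.++⁻ˡ as inside) (Allₚ.++⁺ inside' (Allₚ.++⁻ʳ (x ∷ mid) (Allₚ.++⁻ʳ as inside)))
    , Linked-replaceSuffix as linked (Linked-join ws linked' suffix)
    , trans (head-infix as x (ws ++ cs) (mid ++ cs)) hd
    , (begin
        last (as ++ x ∷ ws ++ cs)            ≡⟨ last-infix as x ws cs ⟩
        just (endpoint x (ws ++ cs))         ≡⟨ cong just (endpoint-++ x ws cs) ⟩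
        just (endpoint (endpoint x ws) cs)   ≡⟨ cong (λ e → just (endpoint e cs)) reaches' ⟩
        just (endpoint (endpoint x mid) cs)  ≡⟨ cong just (endpoint-++ x mid cs) ⟨
        just (endpoint x (mid ++ cs))        ≡⟨ last-infix as x mid cs ⟨
        last (as ++ x ∷ mid ++ cs)           ≡⟨ lst ⟩
        just v                               ∎)
    where
    open ≡-Reasoning
    suffix : Linked Adj (endpoint x ws ∷ cs)
    suffix = subst (λ e → Linked Adj (e ∷ cs)) (sym reaches')
                   (proj₂ (Linked-split mid (Linked-dropPrefix as linked)))

  geodesic-infix-short : ∀ as {x mid cs n} → IsGeodesic V (as ++ x ∷ mid ++ cs) →
                         Walk V x (endpoint x mid) n → length mid ≤ n
  geodesic-infix-short as {x} {mid} {cs} (_ , _ , isWalk , _ , shortest) w =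
    ℕₚ.≤-trans (ℕₚ.+-cancelʳ-≤ (length cs) (length mid) (length (steps w))
                  (ℕₚ.≤-pred (ℕₚ.+-cancelˡ-≤ (length as) _ _ shorter)))
               (short w)
    where
    shorter : length as + suc (length mid + length cs) ≤ length as + suc (length (steps w) + length cs)
    shorter = subst₂ _≤_ (length-infix as x mid cs) (length-infix as x (steps w) cs)
                     (shortest _ (IsWalk-replaceInfix as {mid = mid} {cs = cs} w isWalk))

module _ {A : Set} {P : Pred A 0ℓ} (P? : Decidable P) where

  split-first : ∀ xs → Any P xs →
                ∃ λ pre → ∃ λ x → ∃ λ rest → xs ≡ pre ++ x ∷ rest × All (∁ P) pre × P x
  split-first (y ∷ ys) any with P? y
  ... | yes py  = [] , y , ys , refl , [] , py
  ... | no  ¬py with split-first ys (Any.tail ¬py any)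
  ...   | pre , x , rest , refl , ¬pre , px = y ∷ pre , x , rest , refl , ¬py ∷ ¬pre , px

  split-last : ∀ x xs → P x →
               ∃ λ mid → ∃ λ post → xs ≡ mid ++ post × All (∁ P) post × P (endpoint x mid)
  split-last x []       px = [] , [] , refl , [] , px
  split-last x (y ∷ ys) px with P? y
  ... | yes py with split-last y ys py
  ...   | mid , post , refl , ¬post , pz = y ∷ mid , post , refl , ¬post , pz
  split-last x (y ∷ ys) px | no ¬py with split-last x ys px
  ...   | []      , post , refl , ¬post , pz = [] , y ∷ post , refl , ¬py ∷ ¬post , pz
  ...   | m ∷ mid , post , refl , ¬post , pz = y ∷ m ∷ mid , post , refl , ¬post , pz

  trim : ∀ xs → Any P xs → ∃ λ pre → ∃ λ x → ∃ λ mid → ∃ λ post →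
         xs ≡ pre ++ x ∷ mid ++ post × All (∁ P) pre × All (∁ P) post × P x × P (endpoint x mid)
  trim xs any with split-first xs any
  ... | pre , x , rest , refl , ¬pre , px with split-last x rest px
  ...   | mid , post , refl , ¬post , pz = pre , x , mid , post , refl , ¬pre , ¬post , px , pz

_≟ᴾ_ : DecidableEquality Pt
_≟ᴾ_ = ≡-dec ℤ._≟_ ℤ._≟_

open import Data.List.Membership.DecPropositional _≟ᴾ_ using (_∈?_)

module _ {V : VSet} where

  geodesic-monochromatic-bound :
    ∀ {n ρ T g} → IsGeodesic V g → Unique T → All (_∈ g) T → (∀ {t} → t ∈ T → colour t ≡ ρ) →
    (∀ {s t} → s ∈ T → t ∈ T → Walk V s t n) → 2 * length T ≤ 2 + n
  geodesic-monochromatic-bound {T = []}    _ _ _ _ _ = z≤n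
  geodesic-monochromatic-bound {n} {ρ} {T@(_ ∷ _)} {g}
    geodesic@(_ , _ , (_ , linked , _) , _) uT T⊆g colour≡ρ walks
    with trim (_∈? T) g (lose (All.head T⊆g) (here refl))
  ... | pre , x , mid , post , refl , pre∌ , post∌ , x∈T , z∈T = begin
    2 * length T                      ≤⟨ ℕₚ.*-monoʳ-≤ 2 (Unique⇒length≤ uT (All.tabulate T⊆coloured)) ⟩
    2 * length (coloured (x ∷ mid))   ≤⟨ alternating-count segment ⟩
    2 + length mid                    ≤⟨ ℕₚ.+-monoʳ-≤ 2 (geodesic-infix-short pre {mid = mid} {cs = post}
                                                             geodesic (walks x∈T z∈T)) ⟩
    2 + n                             ∎
    where
    open ℕₚ.≤-Reasoning
    open Alternation colour (λ {p} {q} → Adj-flips-colour {p} {q}) ρ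
    segment : Linked Adj (x ∷ mid)
    segment = proj₁ (Linked-split mid (Linked-dropPrefix pre linked))
    inSegment : ∀ {s} → s ∈ T → s ∈ pre ++ x ∷ mid ++ post → s ∈ x ∷ mid
    inSegment s∈T s∈g with ∈-++⁻ pre s∈g
    ... | inj₁ s∈pre = ⊥-elim (All.lookup pre∌ s∈pre s∈T)
    ... | inj₂ s∈rest with ∈-++⁻ (x ∷ mid) s∈rest
    ...   | inj₁ s∈segment = s∈segment
    ...   | inj₂ s∈post    = ⊥-elim (All.lookup post∌ s∈post s∈T)
    T⊆coloured : ∀ {s} → s ∈ T → s ∈ coloured (x ∷ mid)
    T⊆coloured s∈T = ∈-filter⁺ (λ a → colour a ℙₚ.≟ ρ) (inSegment s∈T (All.lookup T⊆g s∈T)) (colour≡ρ s∈T)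

-- The diamond in the square grid

∣-∣+∣-∣≤-sorted : ∀ {a a' b b'} c → a ≤ a' → b ≤ b' → a' + b' ≤ (a + b) + c → ∣ a - a' ∣ + ∣ b - b' ∣ ≤ c
∣-∣+∣-∣≤-sorted {a} {a'} {b} {b'} c a≤a' b≤b' h = begin
  ∣ a - a' ∣ + ∣ b - b' ∣    ≡⟨ cong₂ _+_ (ℕₚ.m≤n⇒∣m-n∣≡n∸m a≤a') (ℕₚ.m≤n⇒∣m-n∣≡n∸m b≤b') ⟩
  (a' ∸ a) + (b' ∸ b)       ≡⟨ ℕₚ.+-∸-assoc (a' ∸ a) b≤b' ⟨
  (a' ∸ a) + b' ∸ b         ≡⟨ cong (_∸ b) (ℕₚ.+-∸-comm b' a≤a') ⟨
  (a' + b') ∸ a ∸ b         ≡⟨ ℕₚ.∸-+-assoc (a' + b') a b ⟩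
  (a' + b') ∸ (a + b)       ≤⟨ ℕₚ.m≤n+o⇒m∸n≤o (a' + b') (a + b) h ⟩
  c                         ∎
  where open ℕₚ.≤-Reasoning

-- The ℓ₁-ball of radius c is cut out by the four half-planes ±x ± y ≤ c.
∣-∣+∣-∣≤ : ∀ a a' b b' c →
           a + b ≤ (a' + b') + c → a' + b' ≤ (a + b) + c →
           a + b' ≤ (a' + b) + c → a' + b ≤ (a + b') + c →
           ∣ a - a' ∣ + ∣ b - b' ∣ ≤ c
∣-∣+∣-∣≤ a a' b b' c h₁ h₂ h₃ h₄ with ℕₚ.≤-total a a' | ℕₚ.≤-total b b'
... | inj₁ a≤a' | inj₁ b≤b' = ∣-∣+∣-∣≤-sorted c a≤a' b≤b' h₂
... | inj₁ a≤a' | inj₂ b'≤b =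
  subst (λ d → ∣ a - a' ∣ + d ≤ c) (ℕₚ.∣-∣-comm b' b) (∣-∣+∣-∣≤-sorted c a≤a' b'≤b h₄)
... | inj₂ a'≤a | inj₁ b≤b' =
  subst (λ d → d + ∣ b - b' ∣ ≤ c) (ℕₚ.∣-∣-comm a' a) (∣-∣+∣-∣≤-sorted c a'≤a b≤b' h₃)
... | inj₂ a'≤a | inj₂ b'≤b =
  subst₂ (λ d e → d + e ≤ c) (ℕₚ.∣-∣-comm a' a) (ℕₚ.∣-∣-comm b' b) (∣-∣+∣-∣≤-sorted c a'≤a b'≤b h₁)

record IsLine (V : VSet) (h : ℕ → Pt) (B : ℕ) : Set where
  field
    adjacent  : ∀ a → suc a ≤ B → Adj (h a) (h (suc a))
    contained : ∀ a → a ≤ B → V (h a)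

module _ {V : VSet} where
  open IsLine

  IsLine-shift : ∀ {h B} → IsLine V h (suc B) → IsLine V (h ∘ suc) B
  IsLine-shift line = record
    { adjacent  = λ a a<B → adjacent line (suc a) (s≤s a<B)
    ; contained = λ a a≤B → contained line (suc a) (s≤s a≤B)
    }

  line-walk : ∀ {h B} → IsLine V h B → ∀ a a' → a ≤ B → a' ≤ B → Walk V (h a) (h a') ∣ a - a' ∣
  line-walk line zero    zero     _          _           = stay (contained line 0 z≤n)
  line-walk line zero    (suc a') _          (s≤s a'≤B) =
    step (adjacent line 0 (s≤s z≤n)) (contained line 0 z≤n) (line-walk (IsLine-shift line) 0 a' z≤n a'≤B)
  line-walk line (suc a) zero     (s≤s a≤B) _           =
    Walk-weaken (ℕₚ.≤-reflexive (cong suc (ℕₚ.∣-∣-identityʳ a)))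
      (step (Adj-sym (adjacent line a (s≤s a≤B))) (contained line (suc a) (s≤s a≤B))
            (line-walk line a 0 (ℕₚ.m≤n⇒m≤1+n a≤B) z≤n))
  line-walk line (suc a) (suc a') (s≤s a≤B) (s≤s a'≤B) = line-walk (IsLine-shift line) a a' a≤B a'≤B

clamp : (n a : ℕ) → Fin (suc n)
clamp n       zero    = Fin.zero
clamp zero    (suc a) = Fin.zero
clamp (suc n) (suc a) = Fin.suc (clamp n a)

toℕ-clamp : ∀ n a → a ≤ n → toℕ (clamp n a) ≡ a
toℕ-clamp n       zero    _         = refl
toℕ-clamp (suc n) (suc a) (s≤s a≤n) = cong suc (toℕ-clamp n a a≤n)

∣+n-+1+n∣≡1 : ∀ n → ℤ.∣ + n - + suc n ∣ ≡ 1
∣+n-+1+n∣≡1 n = trans (cong ℤ.∣_∣ (ℤₚ.[+m]-[+n]≡m⊖n n (suc n)))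
                      (trans (ℤₚ.∣⊖∣-< (ℕₚ.n<1+n n)) (ℕₚ.m+n∸n≡m 1 n))

module SquareGrid {V : VSet} {N : ℕ} (grid : ContainsSquareGrid V (suc N)) where

  φ : Fin (suc N) × Fin (suc N) → Pt
  φ = proj₁ grid

  φ∈V : ∀ p → V (φ p)
  φ∈V = proj₁ (proj₂ grid)

  φ-injective : ∀ p q → φ p ≡ φ q → p ≡ q
  φ-injective = proj₁ (proj₂ (proj₂ grid))

  φ-adjacent : ∀ p q → AdjFin p q → Adj (φ p) (φ q)
  φ-adjacent = proj₂ (proj₂ (proj₂ grid))

  -- Coordinates beyond N are clamped; every lemma below assumes they are at most N.
  ψ : ℕ → ℕ → Pt
  ψ a b = φ (clamp N a , clamp N b)

  ψ∈V : ∀ a b → V (ψ a b)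
  ψ∈V a b = φ∈V _

  ψ-injective : ∀ {a b a' b'} → a ≤ N → b ≤ N → a' ≤ N → b' ≤ N → ψ a b ≡ ψ a' b' → a ≡ a' × b ≡ b'
  ψ-injective {a} {b} {a'} {b'} a≤N b≤N a'≤N b'≤N eq =
      trans (sym (toℕ-clamp N a a≤N)) (trans (cong (toℕ ∘ proj₁) clamped-eq) (toℕ-clamp N a' a'≤N))
    , trans (sym (toℕ-clamp N b b≤N)) (trans (cong (toℕ ∘ proj₂) clamped-eq) (toℕ-clamp N b' b'≤N))
    where
    clamped-eq : (clamp N a , clamp N b) ≡ (clamp N a' , clamp N b')
    clamped-eq = φ-injective _ _ eq

  ψ-adjacentʰ : ∀ a b → suc a ≤ N → b ≤ N → Adj (ψ a b) (ψ (suc a) b)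
  ψ-adjacentʰ a b a<N b≤N = φ-adjacent _ _ adjacent
    where
    adjacent : AdjFin (clamp N a , clamp N b) (clamp N (suc a) , clamp N b)
    adjacent rewrite toℕ-clamp N a (ℕₚ.<⇒≤ a<N) | toℕ-clamp N (suc a) a<N | toℕ-clamp N b b≤N =
      inj₂ (refl , ∣+n-+1+n∣≡1 a)

  ψ-adjacentᵛ : ∀ a b → a ≤ N → suc b ≤ N → Adj (ψ a b) (ψ a (suc b))
  ψ-adjacentᵛ a b a≤N b<N = φ-adjacent _ _ adjacent
    where
    adjacent : AdjFin (clamp N a , clamp N b) (clamp N a , clamp N (suc b))
    adjacent rewrite toℕ-clamp N a a≤N | toℕ-clamp N b (ℕₚ.<⇒≤ b<N) | toℕ-clamp N (suc b) b<N =
      inj₁ (refl , ∣+n-+1+n∣≡1 b)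

  row : ∀ b → b ≤ N → IsLine V (λ a → ψ a b) N
  row b b≤N = record { adjacent = λ a a<N → ψ-adjacentʰ a b a<N b≤N ; contained = λ a _ → ψ∈V a b }

  column : ∀ a → a ≤ N → IsLine V (ψ a) N
  column a a≤N = record { adjacent = λ b b<N → ψ-adjacentᵛ a b a≤N b<N ; contained = λ b _ → ψ∈V a b }

  ψ-walk : ∀ {a b a' b'} → a ≤ N → b ≤ N → a' ≤ N → b' ≤ N →
           Walk V (ψ a b) (ψ a' b') (∣ a - a' ∣ + ∣ b - b' ∣)
  ψ-walk {a} {b} {a'} {b'} a≤N b≤N a'≤N b'≤N =
    line-walk (row b b≤N) a a' a≤N a'≤N ++ᵂ line-walk (column a' a'≤N) b b' b≤N b'≤N

  colour-step : ∀ {p q n c} → colour q ≡ colour p ⁻¹ → colour p ≡ parity n ℙ.+ c →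
                colour q ≡ parity (suc n) ℙ.+ c
  colour-step {n = n} {c} flip p≡ = trans flip (trans (cong _⁻¹ p≡)
    (sym (trans (cong (ℙ._+ c) (parity-suc n)) (+-⁻¹ˡ (parity n) c))))

  ψ-colour : ∀ a b → a ≤ N → b ≤ N → colour (ψ a b) ≡ parity (a + b) ℙ.+ colour (ψ 0 0)
  ψ-colour zero    zero    _   _   = refl
  ψ-colour zero    (suc b) a≤N b<N =
    colour-step {ψ 0 b} {ψ 0 (suc b)} {b} (Adj-flips-colour (ψ-adjacentᵛ 0 b a≤N b<N))
                (ψ-colour 0 b a≤N (ℕₚ.<⇒≤ b<N))
  ψ-colour (suc a) b       a<N b≤N =
    colour-step {ψ a b} {ψ (suc a) b} {a + b} (Adj-flips-colour (ψ-adjacentʰ a b a<N b≤N))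
                (ψ-colour a b (ℕₚ.<⇒≤ a<N) b≤N)

module DiamondArithmetic (r : ℕ) where

  open +-*-Solver

  x-coord y-coord : ℕ → ℕ → ℕ
  x-coord i j = i + j
  y-coord i j = i + (r ∸ j)

  x+y : ∀ i j → j ≤ r → x-coord i j + y-coord i j ≡ (i + i) + r
  x+y i j j≤r = begin
    (i + j) + (i + (r ∸ j))   ≡⟨ solve 3 (λ i j k → (i :+ j) :+ (i :+ k) := (i :+ i) :+ (j :+ k))
                                         refl i j (r ∸ j) ⟩
    (i + i) + (j + (r ∸ j))   ≡⟨ cong (λ k → (i + i) + k) (ℕₚ.m+[n∸m]≡n j≤r) ⟩
    (i + i) + r               ∎
    where open ≡-Reasoning

  diagonal-≤ : ∀ i j i' j' → i ≤ r → j ≤ r → j' ≤ r →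
               x-coord i j + y-coord i j ≤ (x-coord i' j' + y-coord i' j') + (r + r)
  diagonal-≤ i j i' j' i≤r j≤r j'≤r = begin
    x-coord i j + y-coord i j                 ≡⟨ x+y i j j≤r ⟩
    (i + i) + r                               ≡⟨ ℕₚ.+-comm (i + i) r ⟩
    r + (i + i)                               ≤⟨ ℕₚ.+-mono-≤ (ℕₚ.m≤n+m r (i' + i')) (ℕₚ.+-mono-≤ i≤r i≤r) ⟩
    ((i' + i') + r) + (r + r)                 ≡⟨ cong (_+ (r + r)) (x+y i' j' j'≤r) ⟨
    (x-coord i' j' + y-coord i' j') + (r + r) ∎
    where open ℕₚ.≤-Reasoning

  antidiagonal-≤ : ∀ i j i' j' → j ≤ r →
                   x-coord i j + y-coord i' j' ≤ (x-coord i' j' + y-coord i j) + (r + r)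
  antidiagonal-≤ i j i' j' j≤r = begin
    (i + j) + (i' + (r ∸ j'))              ≡⟨ solve 4 (λ i i' j k → (i :+ j) :+ (i' :+ k) := (i' :+ i) :+ (j :+ k))
                                                    refl i i' j (r ∸ j') ⟩
    (i' + i) + (j + (r ∸ j'))              ≤⟨ ℕₚ.+-mono-≤ (ℕₚ.+-mono-≤ (ℕₚ.m≤m+n i' j') (ℕₚ.m≤m+n i (r ∸ j)))
                                                           (ℕₚ.+-mono-≤ j≤r (ℕₚ.m∸n≤m r j')) ⟩
    ((i' + j') + (i + (r ∸ j))) + (r + r)  ∎
    where open ℕₚ.≤-Reasoning

  diamond-distance : ∀ {i j i' j'} → i ≤ r → j ≤ r → i' ≤ r → j' ≤ r →
                     ∣ x-coord i j - x-coord i' j' ∣ + ∣ y-coord i j - y-coord i' j' ∣ ≤ r + r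
  diamond-distance {i} {j} {i'} {j'} i≤r j≤r i'≤r j'≤r =
    ∣-∣+∣-∣≤ (x-coord i j) (x-coord i' j') (y-coord i j) (y-coord i' j') (r + r)
      (diagonal-≤ i j i' j' i≤r j≤r j'≤r) (diagonal-≤ i' j' i j i'≤r j'≤r j≤r)
      (antidiagonal-≤ i j i' j' j≤r) (antidiagonal-≤ i' j' i j j'≤r)

  diamond-injective : ∀ {i j i' j'} → j ≤ r → j' ≤ r →
                      x-coord i j ≡ x-coord i' j' → y-coord i j ≡ y-coord i' j' → i ≡ i' × j ≡ j'
  diamond-injective {i} {j} {i'} {j'} j≤r j'≤r x≡ y≡ =
    i≡i' , ℕₚ.+-cancelˡ-≡ i j j' (trans x≡ (cong (_+ j') (sym i≡i')))
    where
    i+i≡i'+i' : i + i ≡ i' + i'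
    i+i≡i'+i' = ℕₚ.+-cancelʳ-≡ r (i + i) (i' + i')
                  (trans (sym (x+y i j j≤r)) (trans (cong₂ _+_ x≡ y≡) (x+y i' j' j'≤r)))
    i≡i' : i ≡ i'
    i≡i' = ℕₚ.*-cancelˡ-≡ i i' 2 (trans (double i) (trans i+i≡i'+i' (sym (double i'))))
      where
      double : ∀ n → 2 * n ≡ n + n
      double n = cong (λ k → n + k) (ℕₚ.+-identityʳ n)

remQuot-injective : ∀ {n} k {i j : Fin (n * k)} → Fin.remQuot {n} k i ≡ Fin.remQuot k j → i ≡ j
remQuot-injective {n} k {i} {j} eq =
  trans (sym (Finₚ.combine-remQuot {n} k i))
        (trans (cong (Product.uncurry Fin.combine) eq) (Finₚ.combine-remQuot {n} k j))

parity-[n+n]+m : ∀ n m → parity ((n + n) + m) ≡ parity m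
parity-[n+n]+m n m = begin
  parity ((n + n) + m)                          ≡⟨ ℙₚ.+-homo-+ (n + n) m ⟩
  parity (n + n) ℙ.+ parity m                   ≡⟨ cong (ℙ._+ parity m) (ℙₚ.+-homo-+ n n) ⟩
  (parity n ℙ.+ parity n) ℙ.+ parity m          ≡⟨ cong (ℙ._+ parity m) (ℙₚ.p+p≡0ℙ (parity n)) ⟩
  parity m                                      ∎
  where open ≡-Reasoning

module Diamond {V : VSet} (r : ℕ) (grid : ContainsSquareGrid V (suc (r + r))) where

  open SquareGrid {V} grid
  open DiamondArithmetic r

  Index : Set
  Index = Fin (suc r) × Fin (suc r)

  toℕ≤r : (i : Fin (suc r)) → toℕ i ≤ r
  toℕ≤r i = ℕₚ.≤-pred (Finₚ.toℕ<n i)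

  x-coord≤ : ∀ (i j : Fin (suc r)) → x-coord (toℕ i) (toℕ j) ≤ r + r
  x-coord≤ i j = ℕₚ.+-mono-≤ (toℕ≤r i) (toℕ≤r j)

  y-coord≤ : ∀ (i j : Fin (suc r)) → y-coord (toℕ i) (toℕ j) ≤ r + r
  y-coord≤ i j = ℕₚ.+-mono-≤ (toℕ≤r i) (ℕₚ.m∸n≤m r (toℕ j))

  point : Index → Pt
  point (i , j) = ψ (x-coord (toℕ i) (toℕ j)) (y-coord (toℕ i) (toℕ j))

  point∈V : ∀ p → V (point p)
  point∈V (i , j) = ψ∈V (x-coord (toℕ i) (toℕ j)) (y-coord (toℕ i) (toℕ j))

  point-injective : ∀ {p q} → point p ≡ point q → p ≡ q
  point-injective {i , j} {i' , j'} eq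
    with ψ-injective (x-coord≤ i j) (y-coord≤ i j) (x-coord≤ i' j') (y-coord≤ i' j') eq
  ... | x≡ , y≡ with diamond-injective {toℕ i} {toℕ j} {toℕ i'} {toℕ j'} (toℕ≤r j) (toℕ≤r j') x≡ y≡
  ...   | i≡ , j≡ = cong₂ _,_ (Finₚ.toℕ-injective i≡) (Finₚ.toℕ-injective j≡)

  point-colour : ∀ p → colour (point p) ≡ parity r ℙ.+ colour (ψ 0 0)
  point-colour (i , j) = begin
    colour (ψ (x-coord m n) (y-coord m n))    ≡⟨ ψ-colour _ _ (x-coord≤ i j) (y-coord≤ i j) ⟩
    parity (x-coord m n + y-coord m n) ℙ.+ c  ≡⟨ cong (λ s → parity s ℙ.+ c) (x+y m n (toℕ≤r j)) ⟩
    parity ((m + m) + r) ℙ.+ c                ≡⟨ cong (ℙ._+ c) (parity-[n+n]+m m r) ⟩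
    parity r ℙ.+ c                            ∎
    where
    open ≡-Reasoning
    m n : ℕ
    m = toℕ i
    n = toℕ j
    c : Parity
    c = colour (ψ 0 0)

  point-walk : ∀ p q → Walk V (point p) (point q) (r + r)
  point-walk (i , j) (i' , j') =
    Walk-weaken (diamond-distance (toℕ≤r i) (toℕ≤r j) (toℕ≤r i') (toℕ≤r j'))
                (ψ-walk (x-coord≤ i j) (y-coord≤ i j) (x-coord≤ i' j') (y-coord≤ i' j'))

  diamond : List Pt
  diamond = map (point ∘ Fin.remQuot (suc r)) (allFin (suc r * suc r))

  ∈-diamond⁻ : ∀ {x} → x ∈ diamond → ∃ λ p → x ≡ point p
  ∈-diamond⁻ x∈ with ∈-map⁻ (point ∘ Fin.remQuot (suc r)) {xs = allFin (suc r * suc r)} x∈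
  ... | k , _ , x≡ = Fin.remQuot (suc r) k , x≡

  diamond⊆V : ∀ {x} → x ∈ diamond → V x
  diamond⊆V x∈ with ∈-diamond⁻ x∈
  ... | p , refl = point∈V p

  length-diamond : length diamond ≡ suc r * suc r
  length-diamond = trans (length-map _ (allFin (suc r * suc r))) (length-tabulate id)

  diamond-isGPk : IsGPk V (suc (suc r)) diamond
  diamond-isGPk = Uniqueₚ.map⁺ (remQuot-injective (suc r) ∘ point-injective) (Uniqueₚ.allFin⁺ _)
                , All.tabulate diamond⊆V
                , no-long-geodesic
    where
    no-long-geodesic : ∀ g → IsGeodesic V g →
      ¬ (∃ λ T → Unique T × length T ≥ suc (suc r) × All (_∈ diamond) T × All (_∈ g) T)
    no-long-geodesic g geodesic (T , uT , long , T⊆diamond , T⊆g) =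
      ℕₚ.<⇒≱ long (ℕₚ.*-cancelˡ-≤ 2 (subst (2 * length T ≤_) 2+[r+r]≡2*[1+r] bound))
      where
      bound : 2 * length T ≤ 2 + (r + r)
      bound = geodesic-monochromatic-bound geodesic uT T⊆g colour≡ walks
        where
        colour≡ : ∀ {t} → t ∈ T → colour t ≡ parity r ℙ.+ colour (ψ 0 0)
        colour≡ t∈T with ∈-diamond⁻ (All.lookup T⊆diamond t∈T)
        ... | p , refl = point-colour p
        walks : ∀ {s t} → s ∈ T → t ∈ T → Walk V s t (r + r)
        walks s∈T t∈T with ∈-diamond⁻ (All.lookup T⊆diamond s∈T) | ∈-diamond⁻ (All.lookup T⊆diamond t∈T)
        ... | p , refl | q , refl = point-walk p q
      2+[r+r]≡2*[1+r] : 2 + (r + r) ≡ 2 * suc r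
      2+[r+r]≡2*[1+r] = solve 1 (λ r → con 2 :+ (r :+ r) := con 2 :* (con 1 :+ r)) refl r
        where open +-*-Solver

gpᵏ-lower-bound : ∀ {V} r → ContainsSquareGrid V (suc (r + r)) →
                  ∃ λ S → IsGPk V (suc (suc r)) S × length S ≡ suc r * suc r
gpᵏ-lower-bound {V} r grid = diamond , diamond-isGPk , length-diamond
  where open Diamond {V} r grid

-- Monotone sequences

_↗_ : Rel Pt 0ℓ
p ↗ q = proj₁ p ℤ.≤ proj₁ q × proj₂ p ℤ.≤ proj₂ q × p ≢ q

_↘_ : Rel Pt 0ℓ
p ↘ q = proj₁ p ℤ.≤ proj₁ q × proj₂ q ℤ.≤ proj₂ p × p ≢ q

_↗?_ : Decidable₂ _↗_
p ↗? q = (proj₁ p ℤ.≤? proj₁ q) ×-dec (proj₂ p ℤ.≤? proj₂ q) ×-dec ¬? (p ≟ᴾ q)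

_↘?_ : Decidable₂ _↘_
p ↘? q = (proj₁ p ℤ.≤? proj₁ q) ×-dec (proj₂ q ℤ.≤? proj₂ p) ×-dec ¬? (p ≟ᴾ q)

↗-trans : ∀ {p q s} → p ↗ q → q ↗ s → p ↗ s
↗-trans (x₁ , y₁ , p≢q) (x₂ , y₂ , _) =
  ℤₚ.≤-trans x₁ x₂ , ℤₚ.≤-trans y₁ y₂ , λ { refl → p≢q (×-≡,≡→≡ (ℤₚ.≤-antisym x₁ x₂ , ℤₚ.≤-antisym y₁ y₂)) }

↘-trans : ∀ {p q s} → p ↘ q → q ↘ s → p ↘ s
↘-trans (x₁ , y₁ , p≢q) (x₂ , y₂ , _) =
  ℤₚ.≤-trans x₁ x₂ , ℤₚ.≤-trans y₂ y₁ , λ { refl → p≢q (×-≡,≡→≡ (ℤₚ.≤-antisym x₁ x₂ , ℤₚ.≤-antisym y₂ y₁)) }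

↗-or-↘ : ∀ {p q} → p ≢ q → Comparable _↗_ p q ⊎ Comparable _↘_ p q
↗-or-↘ {p} {q} p≢q with ℤₚ.≤-total (proj₁ p) (proj₁ q) | ℤₚ.≤-total (proj₂ p) (proj₂ q)
... | inj₁ x≤ | inj₁ y≤ = inj₁ (inj₁ (x≤ , y≤ , p≢q))
... | inj₂ x≥ | inj₂ y≥ = inj₁ (inj₂ (x≥ , y≥ , p≢q ∘ sym))
... | inj₁ x≤ | inj₂ y≥ = inj₂ (inj₁ (x≤ , y≥ , p≢q))
... | inj₂ x≥ | inj₁ y≤ = inj₂ (inj₂ (x≥ , y≤ , p≢q ∘ sym))

↗-chain⇒monotone : ∀ {c} → Linked _↗_ c → Unique c × MonotonePts c
↗-chain⇒monotone linked =
    AllPairs.map (proj₂ ∘ proj₂) (Linkedₚ.Linked⇒AllPairs ↗-trans linked)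
  , inj₁ (Linkedₚ.map⁺ (Linked.map proj₁ linked))
  , inj₁ (Linkedₚ.map⁺ (Linked.map (proj₁ ∘ proj₂) linked))

↘-chain⇒monotone : ∀ {c} → Linked _↘_ c → Unique c × MonotonePts c
↘-chain⇒monotone linked =
    AllPairs.map (proj₂ ∘ proj₂) (Linkedₚ.Linked⇒AllPairs ↘-trans linked)
  , inj₁ (Linkedₚ.map⁺ (Linked.map proj₁ linked))
  , inj₂ (Linkedₚ.map⁺ (Linked.map (proj₁ ∘ proj₂) linked))

monotone-subsequence : ∀ m (S : List Pt) → Unique S → m * m < length S →
                       ∃ λ c → All (_∈ S) c × length c ≡ suc m × Unique c × MonotonePts c
monotone-subsequence m S uS long with erdős-szekeres _↗?_ _↘?_ ↗-or-↘ m m S uS long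
... | inj₁ (c , linked , c⊆S , len) = c , c⊆S , len , ↗-chain⇒monotone linked
... | inj₂ (c , linked , c⊆S , len) = c , c⊆S , len , ↘-chain⇒monotone linked

gpᵏ-upper-bound : ∀ {V} m → NaturalLabelingMonGeod V (suc m) → ∀ S → IsGPk V (suc m) S → length S ≤ m * m
gpᵏ-upper-bound m labelling S (uS , S⊆V , no-long-geodesic) = ℕₚ.≮⇒≥ λ long →
  let c , c⊆S , len , uc , monotone = monotone-subsequence m S uS long
      g , geodesic , c⊆g = labelling c len (All.map (All.lookup S⊆V) c⊆S) monotone
  in  no-long-geodesic g geodesic (c , uc , ℕₚ.≤-reflexive (sym len) , c⊆S , c⊆g)

theorem5p6 : (V : VSet) → GridGraph V → (k : ℕ) → 2 ≤ k →
    ContainsSquareGrid V (2 * k ∸ 3) → NaturalLabelingMonGeod V k →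
    GpkEq V k ((k ∸ 1) * (k ∸ 1))
theorem5p6 V _ (suc (suc r)) (s≤s (s≤s z≤n)) grid labelling =
    gpᵏ-lower-bound r (subst (ContainsSquareGrid V) side grid)
  , gpᵏ-upper-bound (suc r) labelling
  where
  open +-*-Solver
  side : 2 * suc (suc r) ∸ 3 ≡ suc (r + r)
  side = cong (_∸ 3) (solve 1 (λ r → con 2 :* (con 2 :+ r) := con 4 :+ (r :+ r)) refl r)
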